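{- Let $\Psi$ be a weighted directed graph with finite vertex set ${\tt N}$ and arc weights $\psi_{ij}$, let $\aleph$ be a partition of ${\tt N}$, and let $F$ be a spanning entering forest of $\Psi$ that is tree-divisible by $\aleph$, with splitting $F^\aleph$. If $({\tt X},{\tt Y})$ is an arc of $F^\aleph$, then $F$ has a unique arc $(x,y)$ with $x\in{\tt X}$, $y\in{\tt Y}$, and the weight of $({\tt X},{\tt Y})$ in $F^\aleph$ is $f^\aleph_{\tt XY}=\psi_{xy}$.
   Context: An entering forest is a directed graph in which at most one arc leaves each vertex and there are no directed cycles; its components are entering trees, whose root is the unique vertex with no outgoing arc. For a subgraph $G$ of $\Psi$ and ${\tt D}\subseteq{\tt N}$, the weight is $\Upsilon^G_{\tt D}=\sum_{(i,j)\in{\tt A}G,\ i\in{\tt D}}\psi_{ij}$ (all arcs of $G$ whose tail is in ${\tt D}$), and $\Upsilon^G=\Upsilon^G_{\tt N}$. $G|_{\tt D}$ is the induced subgraph. For a spanning subgraph $G$ of $\Psi$ (with inherited weights) and ${\tt D}\subseteq{\tt N}$: ${\cal T}^{\bullet}_{\tt D}(G)$ is the set of entering trees contained in $G$ with vertex set ${\tt D}$, $\lambda^\bullet_{\tt D}(G)=\min_{T\in{\cal T}^\bullet_{\tt D}(G)}\Upsilon^T$; ${\cal T}^\circ_{\tt D}(G)$ is the set of entering trees $T\subseteq G$ with ${\tt D}\subset{\tt V}T$, $|{\tt V}T|=|{\tt D}|+1$ and $T|_{\tt D}\in{\cal T}^\bullet_{\tt D}(G)$. For distinct ${\tt X},{\tt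 Y}\in\aleph$, ${\cal T}_{\tt XY}(G)$ is the set of $T\in{\cal T}^\circ_{\tt X}(G)$ whose root lies in ${\tt Y}$, and $\lambda_{\tt XY}(G)=\min_{T\in{\cal T}_{\tt XY}(G)}\Upsilon^T$. $G$ is tree-divisible by $\aleph$ if ${\cal T}^\bullet_{\tt X}(G)\neq\emptyset$ for all ${\tt X}\in\aleph$. The splitting $G^\aleph$ of a tree-divisible $G$ has vertex set $\aleph$, an arc $({\tt X},{\tt Y})$, ${\tt X}\ne{\tt Y}$, iff ${\cal T}_{\tt XY}(G)\ne\emptyset$, with weight $\lambda_{\tt XY}(G)-\lambda^\bullet_{\tt X}(G)$. In particular $f^\aleph_{\tt XY}=\lambda_{\tt XY}(F)-\lambda^\bullet_{\tt X}(F)$.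
   Formalization: The arc weights $\psi_{ij}$ take rational values. -}

module Defs where

open import Data.Nat using (ℕ; suc)
open import Data.Bool using (Bool; true; false; if_then_else_; _∧_)
open import Data.Fin using (Fin; zero; suc)
open import Data.Fin.Subset using (Subset; _∈_; _∉_; _⊆_; _⊂_; ∣_∣; _∩_; ⊤)
open import Data.Fin.Subset.Properties using (_∈?_)
open import Data.Vec using (tabulate)
open import Data.Product using (Σ; ∃; _×_; _,_)
open import Relation.Nullary using (¬_)
open import Relation.Nullary.Decidable using (⌊_⌋)
open import Relation.Binary.PropositionalEquality using (_≡_; _≢_)
open import Relation.Binary.Construct.Closure.Transitive using (TransClosure)
open import Function.Definitions using (Surjective)
open import Data.Rational using (ℚ; 0ℚ; _+_; _-_; _≤_)
import Data.Fin as F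

-- A (directed) graph on the vertex universe Fin n: a vertex set and an arc set.
-- Arc weights are inherited from the ambient weight function ψ.
record Graph (n : ℕ) : Set where
  field
    V : Subset n
    A : Fin n → Fin n → Bool
open Graph public

Arc : ∀ {n} → Graph n → Fin n → Fin n → Set
Arc G i j = A G i j ≡ true

WellFormed : ∀ {n} → Graph n → Set
WellFormed G = ∀ i j → Arc G i j → i ∈ V G × j ∈ V G

_⊑_ : ∀ {n} → Graph n → Graph n → Set
H ⊑ G = WellFormed H × (V H ⊆ V G) × (∀ i j → Arc H i j → Arc G i j)

Spanning : ∀ {n} → Graph n → Set
Spanning G = ∀ v → v ∈ V G

_∣_ : ∀ {n} → Graph n → Subset n → Graph n
V (G ∣ D) = V G ∩ D
A (G ∣ D) i j = A G i j ∧ ⌊ i ∈? D ⌋ ∧ ⌊ j ∈? D ⌋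

EnteringForest : ∀ {n} → Graph n → Set
EnteringForest G =
  (∀ i j k → Arc G i j → Arc G i k → j ≡ k) ×
  (∀ v → ¬ TransClosure (Arc G) v v)

IsRoot : ∀ {n} → Graph n → Fin n → Set
IsRoot G r = r ∈ V G × (∀ j → ¬ Arc G r j)

EnteringTree : ∀ {n} → Graph n → Set
EnteringTree G = EnteringForest G × ∃ λ r → IsRoot G r × (∀ r′ → IsRoot G r′ → r′ ≡ r)

∑ : ∀ {n} → (Fin n → ℚ) → ℚ
∑ {ℕ.zero} f = 0ℚ
∑ {suc n} f = f zero + ∑ (λ i → f (suc i))

Υ : ∀ {n} → (Fin n → Fin n → ℚ) → Graph n → ℚ
Υ ψ G = ∑ λ i → ∑ λ j → if A G i j then ψ i j else 0ℚ

Tbul : ∀ {n} → Graph n → Subset n → Graph n → Set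
Tbul G D T = T ⊑ G × EnteringTree T × V T ≡ D

Tcirc : ∀ {n} → Graph n → Subset n → Graph n → Set
Tcirc G D T = T ⊑ G × EnteringTree T × D ⊂ V T × ∣ V T ∣ ≡ suc ∣ D ∣ × Tbul G D (T ∣ D)

TXY : ∀ {n} → Graph n → Subset n → Subset n → Graph n → Set
TXY G X Y T = Tcirc G X T × ∃ λ r → IsRoot T r × r ∈ Y

IsMinWeight : ∀ {n} → (Fin n → Fin n → ℚ) → (Graph n → Set) → ℚ → Set
IsMinWeight ψ P w = (∃ λ T → P T × Υ ψ T ≡ w) × (∀ T → P T → w ≤ Υ ψ T)

-- the block of a partition given by a labelling part : Fin n → Fin k
block : ∀ {n k} → (Fin n → Fin k) → Fin k → Subset n
block part X = tabulate λ v → ⌊ part v F.≟ X ⌋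

TreeDivisible : ∀ {n k} → Graph n → (Fin n → Fin k) → Set
TreeDivisible G part = ∀ X → ∃ λ T → Tbul G (block part X) T

SplitArc : ∀ {n k} → Graph n → (Fin n → Fin k) → Fin k → Fin k → Set
SplitArc G part X Y = X ≢ Y × ∃ λ T → TXY G (block part X) (block part Y) T

SplitWeight : ∀ {n k} → (Fin n → Fin n → ℚ) → Graph n → (Fin n → Fin k) → Fin k → Fin k → ℚ → Set
SplitWeight ψ G part X Y w =
  ∀ l₁ l₂ → IsMinWeight ψ (TXY G (block part X) (block part Y)) l₁
          → IsMinWeight ψ (Tbul G (block part X)) l₂
          → w ≡ l₁ - l₂

{-# OPTIONS --safe #-}
module Submission where

open import Defs
open import Data.Nat using (ℕ)
open import Data.Fin using (Fin)
open import Data.Fin.Subset using (_∈_)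
open import Data.Product using (Σ; ∃; _×_; _,_)
open import Relation.Binary.PropositionalEquality using (_≡_)
open import Function.Definitions using (Surjective)
open import Data.Rational using (ℚ)

open import Algebra.Bundles using (CommutativeMonoid)
open import Data.Bool using (Bool; true; false; if_then_else_)
import Data.Bool as Bool
open import Data.Bool.Properties using (¬-not; T-≡)
open import Data.Fin using (zero; suc; _≟_)
open import Data.Fin.Properties using (any?; suc-injective)
open import Data.Fin.Subset using (Subset; _∉_; _⊆_; ∣_∣; _─_; ⁅_⁆)
open import Data.Fin.Subset.Properties
  using (_∈?_; p⊂q⇒∣p∣<∣q∣; x∈p∧x≢y⇒x∈p-y; x∈p⇒∣p-x∣<∣p∣)
open import Data.Nat using (_<_)
open import Data.Nat.Properties using (<-irrefl; ≤-<-trans)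
open import Data.Product using (proj₁; proj₂)
open import Data.Rational using (0ℚ; _+_; _-_)
open import Data.Rational.Properties
  using (+-assoc; +-identityˡ; +-0-abelianGroup; +-0-commutativeMonoid)
open import Data.Sum using (_⊎_; inj₁; inj₂)
open import Data.Vec using (lookup)
open import Data.Vec.Properties using (lookup∘tabulate; []=⇒lookup; lookup⇒[]=)
open import Function using (_∘_; Equivalence)
open import Relation.Binary.PropositionalEquality
  using (_≢_; refl; sym; trans; cong; cong₂; subst; module ≡-Reasoning)
open import Relation.Nullary using (¬_; Dec; yes; no; does; contradiction)
open import Relation.Nullary.Decidable using (⌊_⌋; isYes≗does; dec-true; toWitness)

open import Algebra.Properties.AbelianGroup +-0-abelianGroup using (xyx⁻¹≈y)
open import Algebra.Properties.CommutativeSemigroup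
  (CommutativeMonoid.commutativeSemigroup +-0-commutativeMonoid) using (xy∙z≈xz∙y)

-- A tree T of 𝒯_XY(F) has |X| + 1 vertices, so its vertex set is X plus its root r ∈ Y, and the
-- root of T|X, having an arc in T but none inside X, has its arc into r.  Conversely, in any
-- tree S of 𝒯•_X(F) a vertex whose (unique) F-arc leaves X has no arc in S, hence is the root
-- of S.  So F has exactly one arc (x,y) from X to Y, every tree of 𝒯•_X(F) consists of the
-- F-arcs out of X ∖ {x}, and every tree of 𝒯_XY(F) is such a tree plus (x,y); all minima are
-- therefore attained by every candidate and λ_XY(F) − λ•_X(F) = ψ_xy.

private
  variable
    n k : ℕ
    D p q : Subset n
    G H S S′ T : Graph n
    a b i j r x x′ y y′ : Fin n

∣q∣≡1+∣p∣⇒∉p-unique : p ⊆ q → ∣ q ∣ ≡ ℕ.suc ∣ p ∣ →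
                      a ∈ q → a ∉ p → b ∈ q → b ∉ p → a ≡ b
∣q∣≡1+∣p∣⇒∉p-unique {p = p} {q = q} {a = a} {b = b} p⊆q ∣q∣≡ a∈q a∉p b∈q b∉p
  with a ≟ b
... | yes a≡b = a≡b
... | no a≢b = contradiction (≤-<-trans ∣p∣<∣q-a∣ ∣q-a∣<1+∣p∣) (<-irrefl refl)
  where
  ∣q-a∣<1+∣p∣ : ∣ q ─ ⁅ a ⁆ ∣ < ℕ.suc ∣ p ∣
  ∣q-a∣<1+∣p∣ = subst (∣ q ─ ⁅ a ⁆ ∣ <_) ∣q∣≡ (x∈p⇒∣p-x∣<∣p∣ a∈q)
  ∣p∣<∣q-a∣ : ∣ p ∣ < ∣ q ─ ⁅ a ⁆ ∣
  ∣p∣<∣q-a∣ = p⊂q⇒∣p∣<∣q∣ ((λ x∈p → x∈p∧x≢y⇒x∈p-y (p⊆q x∈p) λ { refl → a∉p x∈p }) ,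
                            b , x∈p∧x≢y⇒x∈p-y b∈q (a≢b ∘ sym) , b∉p)

lookup-block : (part : Fin n → Fin k) (X : Fin k) (x : Fin n) →
               lookup (block part X) x ≡ ⌊ part x ≟ X ⌋
lookup-block part X = lookup∘tabulate _

∈-block⁺ : (part : Fin n → Fin k) {X : Fin k} → part x ≡ X → x ∈ block part X
∈-block⁺ {x = x} part {X} px≡X = lookup⇒[]= x _ (begin
  lookup (block part X) x  ≡⟨ lookup-block part X x ⟩
  ⌊ part x ≟ X ⌋           ≡⟨ isYes≗does (part x ≟ X) ⟩
  does (part x ≟ X)        ≡⟨ dec-true (part x ≟ X) px≡X ⟩
  true                     ∎)
  where open ≡-Reasoning

∈-block⁻ : (part : Fin n → Fin k) {X : Fin k} → x ∈ block part X → part x ≡ X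
∈-block⁻ {x = x} part {X} x∈X =
  toWitness (Equivalence.from T-≡ (trans (sym (lookup-block part X x)) ([]=⇒lookup x∈X)))

block-disjoint : (part : Fin n → Fin k) {X Y : Fin k} → X ≢ Y →
                 x ∈ block part Y → x ∉ block part X
block-disjoint part X≢Y x∈Y x∈X = X≢Y (trans (sym (∈-block⁻ part x∈X)) (∈-block⁻ part x∈Y))

∑-cong : {f g : Fin n → ℚ} → (∀ i → f i ≡ g i) → ∑ f ≡ ∑ g
∑-cong {n = ℕ.zero}  f≗g = refl
∑-cong {n = ℕ.suc n} f≗g = cong₂ _+_ (f≗g zero) (∑-cong (f≗g ∘ suc))

∑-shift-at : {f g : Fin n → ℚ} {c : ℚ} →
             (∀ i → i ≢ a → f i ≡ g i) → f a ≡ g a + c → ∑ f ≡ ∑ g + c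
∑-shift-at {a = zero} {f} {g} {c} f≗g fa≡ = begin
  f zero + ∑ (f ∘ suc)      ≡⟨ cong₂ _+_ fa≡ (∑-cong λ i → f≗g (suc i) λ ()) ⟩
  g zero + c + ∑ (g ∘ suc)  ≡⟨ xy∙z≈xz∙y (g zero) c _ ⟩
  g zero + ∑ (g ∘ suc) + c  ∎
  where open ≡-Reasoning
∑-shift-at {a = suc a} {f} {g} {c} f≗g fa≡ = begin
  f zero + ∑ (f ∘ suc)        ≡⟨ cong₂ _+_ (f≗g zero λ ()) (∑-shift-at f≗g∘suc fa≡) ⟩
  g zero + (∑ (g ∘ suc) + c)  ≡⟨ sym (+-assoc (g zero) _ c) ⟩
  g zero + ∑ (g ∘ suc) + c    ∎
  where
  open ≡-Reasoning
  f≗g∘suc : ∀ i → i ≢ a → f (suc i) ≡ g (suc i)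
  f≗g∘suc i i≢a = f≗g (suc i) (i≢a ∘ suc-injective)

module _ (ψ : Fin n → Fin n → ℚ) where

  Υ-cong : (∀ i j → A G i j ≡ A H i j) → Υ ψ G ≡ Υ ψ H
  Υ-cong G≗H = ∑-cong λ i → ∑-cong λ j → cong (λ b → if b then ψ i j else 0ℚ) (G≗H i j)

  Υ-insert-arc : (∀ i j → ¬ (i ≡ x × j ≡ y) → A G i j ≡ A H i j) →
                 Arc G x y → A H x y ≡ false → Υ ψ G ≡ Υ ψ H + ψ x y
  Υ-insert-arc {x = x} {y = y} {G = G} {H = H} G≗H xy∈G xy∉H =
    ∑-shift-at (λ i i≢x → ∑-cong λ j → weight (G≗H i j (i≢x ∘ proj₁)))
               (∑-shift-at (λ j j≢y → weight (G≗H x j (j≢y ∘ proj₂))) xy-weight)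
    where
    weight : ∀ {i j b c} → b ≡ c → (if b then ψ i j else 0ℚ) ≡ (if c then ψ i j else 0ℚ)
    weight = cong _
    xy-weight : (if A G x y then ψ x y else 0ℚ) ≡ (if A H x y then ψ x y else 0ℚ) + ψ x y
    xy-weight rewrite xy∈G | xy∉H = sym (+-identityˡ (ψ x y))

≡true-ext : {b c : Bool} → (b ≡ true → c ≡ true) → (c ≡ true → b ≡ true) → b ≡ c
≡true-ext {true}          b⇒c _   = sym (b⇒c refl)
≡true-ext {false} {true}  _   c⇒b = c⇒b refl
≡true-ext {false} {false} _   _   = refl

AtMostOneOut : Graph n → Set
AtMostOneOut G = ∀ i j k → Arc G i j → Arc G i k → j ≡ k

⊑-arc : G ⊑ H → Arc G i j → Arc H i j
⊑-arc (_ , _ , G⊆H) = G⊆H _ _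

root⊎out-arc : (G : Graph n) → i ∈ V G → IsRoot G i ⊎ ∃ (Arc G i)
root⊎out-arc {i = i} G i∈G with any? (λ j → A G i j Bool.≟ true)
... | yes out-arc   = inj₂ out-arc
... | no no-out-arc = inj₁ (i∈G , λ j ij∈G → no-out-arc (j , ij∈G))

root-unique : EnteringTree G → IsRoot G a → IsRoot G b → a ≡ b
root-unique (_ , _ , _ , unique) a-root b-root = trans (unique _ a-root) (sym (unique _ b-root))

∣-arc⁻ : (G : Graph n) → Arc (G ∣ D) i j → Arc G i j × i ∈ D × j ∈ D
∣-arc⁻ {D = D} {i} {j} G ij∈G∣D with A G i j | i ∈? D | j ∈? D
... | true | yes i∈D | yes j∈D = refl , i∈D , j∈D

∣-arc⁺ : (G : Graph n) → Arc G i j → i ∈ D → j ∈ D → Arc (G ∣ D) i j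
∣-arc⁺ {i = i} {j} {D} G ij∈G i∈D j∈D with A G i j | i ∈? D | j ∈? D
... | true | yes _   | yes _   = refl
... | true | no i∉D | _       = contradiction i∈D i∉D
... | true | yes _   | no j∉D = contradiction j∈D j∉D

Tcirc-outside-unique : Tcirc G D T → a ∈ V T → a ∉ D → b ∈ V T → b ∉ D → a ≡ b
Tcirc-outside-unique (_ , _ , (D⊆VT , _) , ∣VT∣≡ , _) = ∣q∣≡1+∣p∣⇒∉p-unique D⊆VT ∣VT∣≡

Tcirc-root-arc : Tcirc G D T → IsRoot T r → r ∉ D →
                 x ∈ D → (∀ j → ¬ Arc (T ∣ D) x j) → Arc T x r
Tcirc-root-arc {D = D} {T = T} {r = r} {x = x}
  T∈Tcirc@((T-wf , _) , T-tree , (D⊆VT , _) , _) r-root r∉D x∈D x-root∣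
  with root⊎out-arc T (D⊆VT x∈D)
... | inj₁ x-root = contradiction (subst (_∈ D) (root-unique T-tree x-root r-root) x∈D) r∉D
... | inj₂ (j , xj∈T) with j ∈? D
...   | yes j∈D = contradiction (∣-arc⁺ T xj∈T x∈D j∈D) (x-root∣ j)
...   | no j∉D  = subst (Arc T x) j≡r xj∈T
  where
  j≡r : j ≡ r
  j≡r = Tcirc-outside-unique T∈Tcirc (proj₂ (T-wf _ _ xj∈T)) j∉D (proj₁ r-root) r∉D

Tcirc-exit-arc : Tcirc G D T → IsRoot T r → r ∉ D → ∃ λ x → x ∈ D × Arc T x r
Tcirc-exit-arc {D = D}
  T∈Tcirc@(_ , _ , _ , _ , (_ , (_ , x , (x∈T∣D , x-root∣) , _) , VT∣D≡D)) r-root r∉D =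
  x , x∈D , Tcirc-root-arc T∈Tcirc r-root r∉D x∈D x-root∣
  where
  x∈D : x ∈ D
  x∈D = subst (x ∈_) VT∣D≡D x∈T∣D

module _ {F : Graph n} (one-out : AtMostOneOut F) where

  exit-isRoot : S ⊑ F → V S ≡ D → x ∈ D → Arc F x y → y ∉ D → IsRoot S x
  exit-isRoot {D = D} {x = x} S⊑F@(S-wf , _) VS≡D x∈D xy∈F y∉D =
    subst (x ∈_) (sym VS≡D) x∈D , λ j xj∈S →
      y∉D (subst (_∈ D) (one-out _ _ _ (⊑-arc S⊑F xj∈S) xy∈F)
                 (subst (j ∈_) VS≡D (proj₂ (S-wf _ _ xj∈S))))

  exit-arc-unique : Tbul F D S → x ∈ D → Arc F x y → y ∉ D →
                    x′ ∈ D → Arc F x′ y′ → y′ ∉ D → x ≡ x′ × y ≡ y′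
  exit-arc-unique {y′ = y′} (S⊑F , S-tree , VS≡D) x∈D xy∈F y∉D x′∈D x′y′∈F y′∉D =
    x≡x′ , one-out _ _ _ xy∈F (subst (λ t → Arc F t y′) (sym x≡x′) x′y′∈F)
    where
    x≡x′ = root-unique S-tree (exit-isRoot S⊑F VS≡D x∈D xy∈F y∉D)
                              (exit-isRoot S⊑F VS≡D x′∈D x′y′∈F y′∉D)

  ⊑-arc-by-root : S ⊑ F → S′ ⊑ F → EnteringTree S′ → V S ≡ V S′ →
                  IsRoot S r → IsRoot S′ r → Arc S i j → Arc S′ i j
  ⊑-arc-by-root {S = S} {S′ = S′} {j = j}
    S⊑F@(S-wf , _) S′⊑F S′-tree VS≡VS′ r-root r-root′ ij∈S
    with root⊎out-arc S′ (subst (_ ∈_) VS≡VS′ (proj₁ (S-wf _ _ ij∈S)))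
  ... | inj₁ i-root′ =
    contradiction (subst (λ t → Arc S t j) (root-unique S′-tree i-root′ r-root′) ij∈S)
                  (proj₂ r-root j)
  ... | inj₂ (j′ , ij′∈S′) =
    subst (Arc S′ _) (one-out _ _ _ (⊑-arc S′⊑F ij′∈S′) (⊑-arc S⊑F ij∈S)) ij′∈S′

  Tbul-Υ-unique : (ψ : Fin n → Fin n → ℚ) → Tbul F D S → Tbul F D S′ →
                  x ∈ D → Arc F x y → y ∉ D → Υ ψ S ≡ Υ ψ S′
  Tbul-Υ-unique {S = S} {S′ = S′} {x = x}
    ψ (S⊑F , S-tree , VS≡D) (S′⊑F , S′-tree , VS′≡D) x∈D xy∈F y∉D =
    Υ-cong ψ {G = S} {H = S′} λ i j →
      ≡true-ext (⊑-arc-by-root S⊑F S′⊑F S′-tree VS≡VS′ x-root x-root′)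
                (⊑-arc-by-root S′⊑F S⊑F S-tree (sym VS≡VS′) x-root′ x-root)
    where
    VS≡VS′ : V S ≡ V S′
    VS≡VS′ = trans VS≡D (sym VS′≡D)
    x-root : IsRoot S x
    x-root = exit-isRoot S⊑F VS≡D x∈D xy∈F y∉D
    x-root′ : IsRoot S′ x
    x-root′ = exit-isRoot S′⊑F VS′≡D x∈D xy∈F y∉D

  Tcirc-arc-off-exit : Tcirc F D T → IsRoot T r → r ∉ D → x ∈ D → Arc T x r →
                       ¬ (i ≡ x × j ≡ r) → Arc T i j → Arc (T ∣ D) i j
  Tcirc-arc-off-exit {D = D} {T = T} {r = r} {i = i} {j = j}
    T∈Tcirc@(T⊑F@(T-wf , _) , _ , _ , _ , T∣D∈Tbul) r-root r∉D x∈D xr∈T ij≢xr ij∈T =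
    by-cases (i ∈? D) (j ∈? D)
    where
    by-cases : Dec (i ∈ D) → Dec (j ∈ D) → Arc (T ∣ D) i j
    by-cases (no i∉D) _ = contradiction (subst (λ t → Arc T t j) i≡r ij∈T) (proj₂ r-root j)
      where
      i≡r : i ≡ r
      i≡r = Tcirc-outside-unique T∈Tcirc (proj₁ (T-wf _ _ ij∈T)) i∉D (proj₁ r-root) r∉D
    by-cases (yes i∈D) (yes j∈D) = ∣-arc⁺ T ij∈T i∈D j∈D
    by-cases (yes i∈D) (no j∉D)  =
      contradiction (exit-arc-unique T∣D∈Tbul i∈D (⊑-arc T⊑F ij∈T) j∉D x∈D (⊑-arc T⊑F xr∈T) r∉D)
                    ij≢xr

  Tcirc-Υ : (ψ : Fin n → Fin n → ℚ) → Tcirc F D T → IsRoot T r → r ∉ D →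
            x ∈ D → Arc T x r → Υ ψ T ≡ Υ ψ (T ∣ D) + ψ x r
  Tcirc-Υ {D = D} {T = T} ψ T∈Tcirc r-root r∉D x∈D xr∈T =
    Υ-insert-arc ψ {G = T} {H = T ∣ D}
      (λ i j ij≢xr → ≡true-ext (Tcirc-arc-off-exit T∈Tcirc r-root r∉D x∈D xr∈T ij≢xr)
                               (proj₁ ∘ ∣-arc⁻ T))
      xr∈T (¬-not (r∉D ∘ proj₂ ∘ proj₂ ∘ ∣-arc⁻ T))

  Tcirc-Υ-via-Tbul : (ψ : Fin n → Fin n → ℚ) → Tcirc F D T → IsRoot T r → r ∉ D →
                     Tbul F D S → x ∈ D → Arc F x y → y ∉ D → Υ ψ T ≡ Υ ψ S + ψ x y
  Tcirc-Υ-via-Tbul {D = D} {T = T} {S = S}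
    ψ T∈Tcirc@(T⊑F , _ , _ , _ , T∣D∈Tbul) r-root r∉D S∈Tbul x∈D xy∈F y∉D
    with Tcirc-exit-arc T∈Tcirc r-root r∉D
  ... | x₁ , x₁∈D , x₁r∈T
    with exit-arc-unique S∈Tbul x∈D xy∈F y∉D x₁∈D (⊑-arc T⊑F x₁r∈T) r∉D
  ... | refl , refl = begin
    Υ ψ T                ≡⟨ Tcirc-Υ ψ T∈Tcirc r-root r∉D x∈D x₁r∈T ⟩
    Υ ψ (T ∣ D) + ψ _ _  ≡⟨ cong (_+ _) (Tbul-Υ-unique ψ T∣D∈Tbul S∈Tbul x∈D xy∈F y∉D) ⟩
    Υ ψ S + ψ _ _        ∎
    where open ≡-Reasoning

proposition6 : (n k : ℕ) (Ψ : Graph n) (ψ : Fin n → Fin n → ℚ)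
    → Spanning Ψ
    → (part : Fin n → Fin k) → Surjective _≡_ _≡_ part
    → (F : Graph n) → F ⊑ Ψ → Spanning F → EnteringForest F
    → TreeDivisible F part
    → (X Y : Fin k) → SplitArc F part X Y
    → Σ (Fin n) λ x → Σ (Fin n) λ y →
        (Arc F x y × part x ≡ X × part y ≡ Y
          × (∀ x′ y′ → Arc F x′ y′ → part x′ ≡ X → part y′ ≡ Y → x′ ≡ x × y′ ≡ y))
        × SplitWeight ψ F part X Y (ψ x y)
proposition6 n k Ψ ψ _ part _ F _ _ (one-out , _) _ X Y
  (X≢Y , T , T∈Tcirc@(T⊑F , _ , _ , _ , T∣X∈Tbul) , r , r-root , r∈Y)
  with Tcirc-exit-arc T∈Tcirc r-root (block-disjoint part X≢Y r∈Y)
... | x , x∈X , xr∈T = x , r , (xr∈F , ∈-block⁻ part x∈X , ∈-block⁻ part r∈Y , unique) , weight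
  where
  ∉X : ∀ {y} → y ∈ block part Y → y ∉ block part X
  ∉X = block-disjoint part X≢Y
  xr∈F : Arc F x r
  xr∈F = ⊑-arc T⊑F xr∈T
  unique : ∀ x′ y′ → Arc F x′ y′ → part x′ ≡ X → part y′ ≡ Y → x′ ≡ x × y′ ≡ r
  unique x′ y′ x′y′∈F x′∈X y′∈Y =
    exit-arc-unique one-out T∣X∈Tbul (∈-block⁺ part x′∈X) x′y′∈F (∉X (∈-block⁺ part y′∈Y))
                                     x∈X xr∈F (∉X r∈Y)
  weight : SplitWeight ψ F part X Y (ψ x r)
  weight l₁ l₂ ((T₁ , (T₁∈Tcirc , _ , r₁-root , r₁∈Y) , Υ≡l₁) , _) ((S , S∈Tbul , Υ≡l₂) , _) = begin
    ψ x r               ≡⟨ sym (xyx⁻¹≈y l₂ (ψ x r)) ⟩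
    l₂ + ψ x r - l₂     ≡⟨ cong (λ l → l + ψ x r - l₂) (sym Υ≡l₂) ⟩
    Υ ψ S + ψ x r - l₂  ≡⟨ cong (_- l₂) (sym Υ≡) ⟩
    Υ ψ T₁ - l₂         ≡⟨ cong (_- l₂) Υ≡l₁ ⟩
    l₁ - l₂             ∎
    where
    open ≡-Reasoning
    Υ≡ : Υ ψ T₁ ≡ Υ ψ S + ψ x r
    Υ≡ = Tcirc-Υ-via-Tbul one-out ψ T₁∈Tcirc r₁-root (∉X r₁∈Y) S∈Tbul x∈X xr∈F (∉X r∈Y)
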